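{- Let $n\geq 5$. For every $j\in\mathbb{Z}$, the number of directed spanning trees of $\overrightarrow{C_n^2}$ rooted by $v_j$ is $t(\overrightarrow{C_n^2},v_j)=J_n$.
   Context: For $n\geq 5$, the directed square cycle $\overrightarrow{C_n^2}$ has vertex set $\mathbb{Z}_n$, with $v_i=i+n\mathbb{Z}$ for $i\in\mathbb{Z}$, and edge set $\{(v_i,v_{i+1}),(v_i,v_{i+2})\mid i\in\mathbb{Z}\}$. A directed spanning tree rooted by $u$ is a spanning subgraph whose underlying undirected graph is connected, which has no closed paths, in which every vertex $v\neq u$ has in-degree $1$, and in which every vertex $v\neq u$ is reachable from $u$ by a directed path; $t(\overrightarrow{G},u)$ is the number of such trees. The Jacobsthal sequence is $J_0=0$, $J_1=1$, $J_{m+2}=J_{m+1}+2J_m$ for $m\geq 0$. -}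

module Defs where

open import Data.Nat as ℕ using (ℕ; zero; suc; NonZero)
open import Data.Integer as ℤ using (ℤ; +_)
open import Data.Integer.DivMod using (_%ℕ_; n%ℕd<d)
open import Data.Fin as Fin using (Fin; toℕ; fromℕ<)
open import Data.Fin.Properties using (_≟_)
open import Data.Bool using (Bool; true; false; _∧_; if_then_else_)
open import Data.Vec using (Vec; lookup)
open import Data.List using (List; map; length; allFin)
open import Data.Nat.ListAction using (sum)
open import Data.List.Membership.Propositional using (_∈_)
open import Data.List.Relation.Unary.Unique.Propositional using (Unique)
open import Data.Product using (Σ; ∃; _×_; _,_)
open import Data.Sum using (_⊎_)
open import Data.Empty using (⊥)
open import Relation.Nullary using (¬_; does)
open import Relation.Binary.PropositionalEquality using (_≡_)
open import Relation.Binary.Construct.Closure.ReflexiveTransitive using (Star)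
open import Relation.Binary.Construct.Closure.Transitive using (TransClosure)
open import Relation.Binary.Construct.Closure.Symmetric using (SymClosure)
open import Function.Bundles using (_⇔_)

J : ℕ → ℕ
J zero = 0
J (suc zero) = 1
J (suc (suc m)) = J (suc m) ℕ.+ 2 ℕ.* J m

-- Vertex set ℤ_n, represented by Fin n; v n i is the class of i ∈ ℤ.
v : (n : ℕ) .{{_ : NonZero n}} → ℤ → Fin n
v n i = fromℕ< (n%ℕd<d i n)

-- The edge set of the directed square cycle is indexed by (k , i) with i ∈ Fin n
-- (standing for v_i) and k ∈ {1,2}: the edge (v_i , v_{i+k}).
-- A spanning subgraph is a subset of the edge set, given by two
-- characteristic vectors: fst for edges (v_i,v_{i+1}), snd for edges (v_i,v_{i+2}).
Subgraph : ℕ → Set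
Subgraph n = Vec Bool n × Vec Bool n

src : (n : ℕ) .{{_ : NonZero n}} → Fin n → Fin n
src n i = v n (+ toℕ i)

tgt₁ tgt₂ : (n : ℕ) .{{_ : NonZero n}} → Fin n → Fin n
tgt₁ n i = v n (+ toℕ i ℤ.+ + 1)
tgt₂ n i = v n (+ toℕ i ℤ.+ + 2)

Arc : (n : ℕ) .{{_ : NonZero n}} → Subgraph n → Fin n → Fin n → Set
Arc n (S₁ , S₂) a b =
  (Σ (Fin n) λ i → lookup S₁ i ≡ true × src n i ≡ a × tgt₁ n i ≡ b)
  ⊎ (Σ (Fin n) λ i → lookup S₂ i ≡ true × src n i ≡ a × tgt₂ n i ≡ b)

indeg : (n : ℕ) .{{_ : NonZero n}} → Subgraph n → Fin n → ℕ
indeg n (S₁ , S₂) w =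
  sum (map (λ i → (if lookup S₁ i ∧ does (tgt₁ n i ≟ w) then 1 else 0)
                 ℕ.+ (if lookup S₂ i ∧ does (tgt₂ n i ≟ w) then 1 else 0))
           (allFin n))

record IsRootedSpanningTree (n : ℕ) .{{_ : NonZero n}} (u : Fin n) (S : Subgraph n) : Set where
  field
    connected   : ∀ a b → Star (SymClosure (Arc n S)) a b
    noClosedPath : ∀ a → ¬ TransClosure (Arc n S) a a
    indegOne    : ∀ w → ¬ (w ≡ u) → indeg n S w ≡ 1
    reachable   : ∀ w → ¬ (w ≡ u) → Star (Arc n S) u w

NumRootedSpanningTrees : (n : ℕ) .{{_ : NonZero n}} → Fin n → ℕ → Set
NumRootedSpanningTrees n u m =
  Σ (List (Subgraph n)) λ L →
    Unique L × (∀ S → (S ∈ L) ⇔ IsRootedSpanningTree n u S) × length L ≡ m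

-- Fix the root and number the vertices by their position 0, …, n − 1 counted forward from it.
-- A vertex at position q ≥ 1 has exactly two in-arcs, from q − 1 and from q − 2, so a spanning
-- subgraph in which the root has in-degree 0 and every other vertex in-degree 1 amounts to a
-- word c₁ ⋯ c_{n−1} over Bool (c_q says which of the two arcs into q is used). Apart from arcs
-- into the root, every arc increases the position except the one from n − 1 to 1, used iff
-- c₁ = false; hence the only possible cycle runs through position 1, and the subgraph is a tree
-- iff descending from n − 1 along the chosen arcs ends at the root rather than at 1. A two-bit
-- automaton reading the word decides this, and counting its accepted words gives
-- 2^(n−2) + J (n−2) = J n.
module Submission where

open import Defs
open import Algebra.Properties.CommutativeSemigroup using (interchange)
open import Data.Bool using (Bool; true; false; not; _∧_; if_then_else_)
open import Data.Bool.Properties using (∧-zeroʳ; ∧-identityʳ)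
open import Data.Empty using (⊥; ⊥-elim)
open import Data.Fin as Fin using (Fin; toℕ; fromℕ<)
open import Data.Fin.Properties using (toℕ-fromℕ<; toℕ-injective; toℕ<n; _≟_; suc-injective)
open import Data.Integer using (ℤ)
open import Data.List as List using (List; []; _∷_; _++_; map; length; applyUpTo)
open import Data.List.Membership.Propositional using (_∈_)
open import Data.List.Membership.Propositional.Properties using (∈-map⁺; ∈-map⁻; ∈-++⁻; ∈-++⁺ˡ; ∈-++⁺ʳ)
open import Data.List.Properties using (length-map; length-++; ∷-injectiveʳ; length-applyUpTo; map-∘; map-id-local; map-tabulate)
open import Data.List.Relation.Unary.All as All using (All; [])
open import Data.List.Relation.Unary.Any using (here)
open import Data.List.Relation.Unary.Unique.Propositional using (Unique; []; _∷_)
import Data.List.Relation.Unary.Unique.Propositional.Properties as Unique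
open import Data.Nat using (ℕ; zero; suc; z≤n; s≤s; _+_; _*_; _∸_; _^_; _≤_; _<_; NonZero; _%_)
open import Data.Nat.DivMod using (%-distribˡ-+; m%n%n≡m%n; [m+n]%n≡m%n; m<n⇒m%n≡m; m%n<n; n%n≡0)
open import Data.Nat.ListAction using (sum)
open import Data.Nat.Properties
  using (+-assoc; +-comm; +-identityʳ; m+[n∸m]≡n; m∸n+n≡m; +-commutativeSemigroup; <⇒≤; ≤-trans; <-trans; n<1+n;
         ∸-monoˡ-≤; ∸-monoʳ-<; 0≢1+n; <⇒≢; m<n⇒0<n∸m)
  renaming (suc-injective to ℕ-suc-injective)
open import Data.Nat.Tactic.RingSolver using (solve-∀)
open import Data.Product using (∃-syntax; _×_; _,_; proj₁; proj₂)
open import Data.Sum using (_⊎_; inj₁; inj₂)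
open import Data.Vec using (Vec; lookup; tabulate)
open import Data.Vec.Properties using (lookup∘tabulate; tabulate-cong; tabulate∘lookup)
open import Function using (id; _∘_)
open import Function.Bundles using (mk⇔)
open import Relation.Binary.Construct.Closure.ReflexiveTransitive using (Star; ε; _◅_; _◅◅_; gmap; reverse)
open import Relation.Binary.Construct.Closure.Symmetric using (fwd; bwd)
open import Relation.Binary.Construct.Closure.Transitive using (TransClosure; [_]; _∷_)
open import Relation.Binary.PropositionalEquality hiding (J)
open import Relation.Nullary using (¬_; Dec; yes; no; does)

module _ {A : Set} {_↝_ : A → A → Set} where

  star-then-arc : ∀ {x y z} → Star _↝_ x y → y ↝ z → TransClosure _↝_ x z
  star-then-arc ε       y↝z = [ y↝z ]
  star-then-arc (a ◅ s) y↝z = a ∷ star-then-arc s y↝z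

  arc-then-star : ∀ {x y z} → x ↝ y → Star _↝_ y z → TransClosure _↝_ x z
  arc-then-star x↝y ε       = [ x↝y ]
  arc-then-star x↝y (a ◅ s) = x↝y ∷ arc-then-star a s

  last-arc : ∀ {x z} → TransClosure _↝_ x z → ∃[ w ] Star _↝_ x w × w ↝ z
  last-arc [ a ]   = _ , ε , a
  last-arc (a ∷ t) with last-arc t
  ... | w , s , b = w , a ◅ s , b

  module _ (predecessor-unique : ∀ {x y z} → x ↝ z → y ↝ z → x ≡ y) where

    -- Inductively x′ lies on a cycle; its last arc w ↝ x′ has w = x, so x ↝ x′ ↝* x.
    reaches-cycle⇒on-cycle : ∀ {x y} → Star _↝_ x y → TransClosure _↝_ y y → TransClosure _↝_ x x
    reaches-cycle⇒on-cycle ε c = c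
    reaches-cycle⇒on-cycle {x} (x↝x′ ◅ s) c with last-arc (reaches-cycle⇒on-cycle s c)
    ... | w , x′↝*w , w↝x′ = subst (TransClosure _↝_ x) (predecessor-unique w↝x′ x↝x′) (arc-then-star x↝x′ x′↝*w)

    rooted⇒acyclic : ∀ root → (∀ {y} → ¬ y ↝ root) → (∀ x → Star _↝_ root x) → ∀ x → ¬ TransClosure _↝_ x x
    rooted⇒acyclic root no-arc-into-root reach x c with last-arc (reaches-cycle⇒on-cycle (reach x) c)
    ... | _ , _ , w↝root = no-arc-into-root w↝root

sum-tabulate-+ : ∀ {m} (f g : Fin m → ℕ) → sum (List.tabulate (λ i → f i + g i)) ≡ sum (List.tabulate f) + sum (List.tabulate g)
sum-tabulate-+ {zero}  f g = refl
sum-tabulate-+ {suc m} f g =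
  trans (cong (f Fin.zero + g Fin.zero +_) (sum-tabulate-+ (f ∘ Fin.suc) (g ∘ Fin.suc)))
        (interchange +-commutativeSemigroup (f Fin.zero) (g Fin.zero) _ _)

sum-tabulate-≡0 : ∀ {m} (f : Fin m → ℕ) → (∀ i → f i ≡ 0) → sum (List.tabulate f) ≡ 0
sum-tabulate-≡0 {zero}  f f≡0 = refl
sum-tabulate-≡0 {suc m} f f≡0 = cong₂ _+_ (f≡0 Fin.zero) (sum-tabulate-≡0 (f ∘ Fin.suc) (f≡0 ∘ Fin.suc))

sum-tabulate-single : ∀ {m} (f : Fin m → ℕ) k → (∀ i → i ≢ k → f i ≡ 0) → sum (List.tabulate f) ≡ f k
sum-tabulate-single f Fin.zero f≡0 =
  trans (cong (f Fin.zero +_) (sum-tabulate-≡0 (f ∘ Fin.suc) (λ i → f≡0 (Fin.suc i) λ ())))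
        (+-identityʳ _)
sum-tabulate-single f (Fin.suc k) f≡0 =
  cong₂ _+_ (f≡0 Fin.zero λ ()) (sum-tabulate-single (f ∘ Fin.suc) k (λ i i≢k → f≡0 (Fin.suc i) (i≢k ∘ suc-injective)))

module _ (n : ℕ) .{{_ : NonZero n}} where

  [m%n+k]%n≡[m+k]%n : ∀ m k → (m % n + k) % n ≡ (m + k) % n
  [m%n+k]%n≡[m+k]%n m k = begin
    (m % n + k) % n          ≡⟨ %-distribˡ-+ (m % n) k n ⟩
    (m % n % n + k % n) % n  ≡⟨ cong (λ x → (x + k % n) % n) (m%n%n≡m%n m n) ⟩
    (m % n + k % n) % n      ≡⟨ %-distribˡ-+ m k n ⟨
    (m + k) % n              ∎
    where open ≡-Reasoning

  [m+k%n]%n≡[m+k]%n : ∀ m k → (m + k % n) % n ≡ (m + k) % n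
  [m+k%n]%n≡[m+k]%n m k = begin
    (m + k % n) % n  ≡⟨ cong (_% n) (+-comm m (k % n)) ⟩
    (k % n + m) % n  ≡⟨ [m%n+k]%n≡[m+k]%n k m ⟩
    (k + m) % n      ≡⟨ cong (_% n) (+-comm k m) ⟩
    (m + k) % n      ∎
    where open ≡-Reasoning

  -- Adding n ∸ k undoes the shift by k.
  [a+k]%n≡[b+k]%n⇒a≡b : ∀ {a b} k → a < n → b < n → k ≤ n → (a + k) % n ≡ (b + k) % n → a ≡ b
  [a+k]%n≡[b+k]%n⇒a≡b {a} {b} k a<n b<n k≤n eq = begin
    a                               ≡⟨ unshift a a<n ⟨
    ((a + k) % n + (n ∸ k)) % n     ≡⟨ cong (λ x → (x + (n ∸ k)) % n) eq ⟩
    ((b + k) % n + (n ∸ k)) % n     ≡⟨ unshift b b<n ⟩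
    b                               ∎
    where
    open ≡-Reasoning
    unshift : ∀ x → x < n → ((x + k) % n + (n ∸ k)) % n ≡ x
    unshift x x<n = begin
      ((x + k) % n + (n ∸ k)) % n  ≡⟨ [m%n+k]%n≡[m+k]%n (x + k) (n ∸ k) ⟩
      (x + k + (n ∸ k)) % n        ≡⟨ cong (_% n) (trans (+-assoc x k (n ∸ k)) (cong (x +_) (m+[n∸m]≡n k≤n))) ⟩
      (x + n) % n                  ≡⟨ [m+n]%n≡m%n x n ⟩
      x % n                        ≡⟨ m<n⇒m%n≡m x<n ⟩
      x                            ∎

branch : (Bool → List (List Bool)) → List (List Bool)
branch f = map (true ∷_) (f true) ++ map (false ∷_) (f false)

branch-unique : ∀ {f} → (∀ b → Unique (f b)) → Unique (branch f)
branch-unique uf = Unique.++⁺ (Unique.map⁺ ∷-injectiveʳ (uf true)) (Unique.map⁺ ∷-injectiveʳ (uf false)) disjoint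
  where
  disjoint : ∀ {v} → ¬ (v ∈ map (true ∷_) _ × v ∈ map (false ∷_) _)
  disjoint (p , q) with ∈-map⁻ (true ∷_) p | ∈-map⁻ (false ∷_) q
  ... | _ , _ , refl | _ , _ , ()

length-branch : ∀ f → length (branch f) ≡ length (f true) + length (f false)
length-branch f = trans (length-++ (map (true ∷_) (f true))) (cong₂ _+_ (length-map _ (f true)) (length-map _ (f false)))

∈-branch⁺ : ∀ {f} b {bs} → bs ∈ f b → b ∷ bs ∈ branch f
∈-branch⁺ true  p = ∈-++⁺ˡ (∈-map⁺ (true ∷_) p)
∈-branch⁺ {f} false p = ∈-++⁺ʳ (map (true ∷_) (f true)) (∈-map⁺ (false ∷_) p)

∈-branch⁻ : ∀ {f bs} → bs ∈ branch f → ∃[ b ] ∃[ cs ] bs ≡ b ∷ cs × cs ∈ f b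
∈-branch⁻ {f} p with ∈-++⁻ (map (true ∷_) (f true)) p
... | inj₁ q with ∈-map⁻ (true ∷_) q
...   | cs , r , refl = true , cs , refl , r
∈-branch⁻ p | inj₂ q with ∈-map⁻ (false ∷_) q
...   | cs , r , refl = false , cs , refl , r

module Automaton {Q : Set} (δ : Bool → Q → Q) (final : Q → Bool) where

  accepts : Q → List Bool → Bool
  accepts q []       = final q
  accepts q (b ∷ bs) = accepts (δ b q) bs

  words : ℕ → Q → List (List Bool)
  words zero    q = if final q then [] ∷ [] else []
  words (suc k) q = branch (λ b → words k (δ b q))

  words-unique : ∀ k q → Unique (words k q)
  words-unique zero q with final q
  ... | true  = [] ∷ []
  ... | false = []
  words-unique (suc k) q = branch-unique (λ b → words-unique k (δ b q))

  length-words-suc : ∀ k q → length (words (suc k) q) ≡ length (words k (δ true q)) + length (words k (δ false q))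
  length-words-suc k q = length-branch (λ b → words k (δ b q))

  ∈-words⁺ : ∀ k q bs → length bs ≡ k → accepts q bs ≡ true → bs ∈ words k q
  ∈-words⁺ zero q [] refl acc rewrite acc = here refl
  ∈-words⁺ (suc k) q (b ∷ bs) len acc = ∈-branch⁺ {λ b → words k (δ b q)} b (∈-words⁺ k (δ b q) bs (ℕ-suc-injective len) acc)

  ∈-words⁻ : ∀ k q bs → bs ∈ words k q → length bs ≡ k × accepts q bs ≡ true
  ∈-words⁻ zero q bs p with final q in acc
  ∈-words⁻ zero q .[] (here refl) | true = refl , acc
  ∈-words⁻ (suc k) q bs p with ∈-branch⁻ {λ b → words k (δ b q)} p
  ... | b , cs , refl , r with ∈-words⁻ k (δ b q) cs r
  ...   | len , acc = cong suc len , acc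

J[2+k]≡2^k+J[k] : ∀ k → J (2 + k) ≡ 2 ^ k + J k
J[2+k]≡2^k+J[k] zero          = refl
J[2+k]≡2^k+J[k] (suc zero)    = refl
J[2+k]≡2^k+J[k] (suc (suc k)) = begin
  J (3 + k) + 2 * J (2 + k)                  ≡⟨ cong₂ (λ a b → a + 2 * b) (J[2+k]≡2^k+J[k] (suc k)) (J[2+k]≡2^k+J[k] k) ⟩
  (2 ^ (1 + k) + J (1 + k)) + 2 * (2 ^ k + J k)  ≡⟨ rearrange (2 ^ k) (J (1 + k)) (J k) ⟩
  2 ^ (2 + k) + (J (1 + k) + 2 * J k)         ∎
  where
  open ≡-Reasoning
  rearrange : ∀ p a b → (2 * p + a) + 2 * (p + b) ≡ 2 * (2 * p) + (a + 2 * b)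
  rearrange = solve-∀

-- Read along increasing positions p, the state (x , y) records for p − 1 and p whether
-- descending along the chosen parent arcs ends at the root (true) or at position 1 (false).
descend : Bool → Bool × Bool → Bool × Bool
descend b (x , y) = y , (if b then y else x)

open Automaton descend proj₂

length-words-tt : ∀ k → length (words k (true , true)) ≡ 2 ^ k
length-words-tt zero    = refl
length-words-tt (suc k) =
  trans (length-words-suc k _) (trans (cong₂ _+_ (length-words-tt k) (length-words-tt k)) (cong (2 ^ k +_) (sym (+-identityʳ _))))

length-words-ff : ∀ k → length (words k (false , false)) ≡ 0
length-words-ff zero    = refl
length-words-ff (suc k) = trans (length-words-suc k _) (cong₂ _+_ (length-words-ff k) (length-words-ff k))

length-words-tf : ∀ k → length (words k (true , false)) ≡ J k
length-words-ft : ∀ k → length (words k (false , true)) ≡ J (suc k)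
length-words-tf zero    = refl
length-words-tf (suc k) = trans (length-words-suc k _) (cong₂ _+_ (length-words-ff k) (length-words-ft k))
length-words-ft zero    = refl
length-words-ft (suc k) =
  trans (length-words-suc k _) (trans (cong₂ _+_ (length-words-tt k) (length-words-tf k)) (sym (J[2+k]≡2^k+J[k] k)))

-- Indexing with default true; the default makes label-recurrence hold for every position.
_!_ : List Bool → ℕ → Bool
[]       ! _     = true
(b ∷ bs) ! zero  = b
(b ∷ bs) ! suc p = bs ! p

label : Bool × Bool → List Bool → ℕ → Bool
label (x , _) bs       zero    = x
label (_ , y) []       (suc p) = y
label q       (b ∷ bs) (suc p) = label (descend b q) bs p

label-recurrence : ∀ q bs p → label q bs (2 + p) ≡ (if bs ! p then label q bs (1 + p) else label q bs p)
label-recurrence q       []            p       = refl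
label-recurrence (x , y) (b ∷ [])      zero    = refl
label-recurrence (x , y) (b ∷ _ ∷ _)   zero    = refl
label-recurrence q       (b ∷ bs)      (suc p) = label-recurrence (descend b q) bs p

accepts≡label : ∀ q bs → accepts q bs ≡ label q bs (suc (length bs))
accepts≡label (x , y) []       = refl
accepts≡label q       (b ∷ bs) = accepts≡label (descend b q) bs

accepts-tt : ∀ bs → accepts (true , true) bs ≡ true
accepts-tt []           = refl
accepts-tt (true ∷ bs)  = accepts-tt bs
accepts-tt (false ∷ bs) = accepts-tt bs

applyUpTo-! : ∀ f bs → (∀ p → p < length bs → f p ≡ bs ! p) → applyUpTo f (length bs) ≡ bs
applyUpTo-! f []       f≡ = refl
applyUpTo-! f (b ∷ bs) f≡ = cong₂ _∷_ (f≡ zero (s≤s z≤n)) (applyUpTo-! (f ∘ suc) bs (λ p p<n → f≡ (suc p) (s≤s p<n)))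

!-applyUpTo : ∀ f m p → p < m → applyUpTo f m ! p ≡ f p
!-applyUpTo f (suc m) zero    _         = refl
!-applyUpTo f (suc m) (suc p) (s≤s p<m) = !-applyUpTo (f ∘ suc) m p p<m

-- Whether descending from position p along the parent arcs ends at the root rather than at position 1.
rootward : List Bool → ℕ → Bool
rootward cs p = label (false , true) cs (suc p)

rootward-0 : ∀ cs → rootward cs 0 ≡ true
rootward-0 []      = refl
rootward-0 (_ ∷ _) = refl

rootward-1 : ∀ cs → rootward cs 1 ≡ cs ! 0
rootward-1 cs with cs ! 0 | label-recurrence (false , true) cs 0
... | true  | eq = trans eq (rootward-0 cs)
... | false | eq = eq

rootward-2+ : ∀ cs p → rootward cs (2 + p) ≡ (if cs ! suc p then rootward cs (1 + p) else rootward cs p)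
rootward-2+ cs p = label-recurrence (false , true) cs (suc p)

module Arcs (n : ℕ) .{{_ : NonZero n}} where

  -- tgt₁ = shift 1 and tgt₂ = shift 2 definitionally.
  shift : ℕ → Fin n → Fin n
  shift k i = fromℕ< (m%n<n (toℕ i + k) n)

  toℕ-shift : ∀ k i → toℕ (shift k i) ≡ (toℕ i + k) % n
  toℕ-shift k i = toℕ-fromℕ< _

  shift-injective : ∀ {k i j} → k ≤ n → shift k i ≡ shift k j → i ≡ j
  shift-injective {k} {i} {j} k≤n eq = toℕ-injective
    ([a+k]%n≡[b+k]%n⇒a≡b n k (toℕ<n i) (toℕ<n j) k≤n
      (trans (sym (toℕ-shift k i)) (trans (cong toℕ eq) (toℕ-shift k j))))

  src-i≡i : ∀ i → src n i ≡ i
  src-i≡i i = toℕ-injective (trans (toℕ-fromℕ< _) (m<n⇒m%n≡m (toℕ<n i)))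

  count-arcs-into : ∀ k (S : Vec Bool n) w i₀ → k ≤ n → shift k i₀ ≡ w →
    sum (List.tabulate (λ i → if lookup S i ∧ does (shift k i ≟ w) then 1 else 0)) ≡ (if lookup S i₀ then 1 else 0)
  count-arcs-into k S w i₀ k≤n i₀↦w = trans (sum-tabulate-single _ i₀ other) (at-i₀ (shift k i₀ ≟ w))
    where
    other : ∀ i → i ≢ i₀ → (if lookup S i ∧ does (shift k i ≟ w) then 1 else 0) ≡ 0
    other i i≢i₀ with shift k i ≟ w
    ... | yes i↦w = ⊥-elim (i≢i₀ (shift-injective k≤n (trans i↦w (sym i₀↦w))))
    ... | no _ rewrite ∧-zeroʳ (lookup S i) = refl
    at-i₀ : (d : Dec (shift k i₀ ≡ w)) → (if lookup S i₀ ∧ does d then 1 else 0) ≡ (if lookup S i₀ then 1 else 0)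
    at-i₀ (yes _) rewrite ∧-identityʳ (lookup S i₀) = refl
    at-i₀ (no i₀↛w) = ⊥-elim (i₀↛w i₀↦w)

  indeg≡indicators : ∀ (S₁ S₂ : Vec Bool n) w i₁ i₂ → 2 ≤ n → tgt₁ n i₁ ≡ w → tgt₂ n i₂ ≡ w →
    indeg n (S₁ , S₂) w ≡ (if lookup S₁ i₁ then 1 else 0) + (if lookup S₂ i₂ then 1 else 0)
  indeg≡indicators S₁ S₂ w i₁ i₂ 2≤n i₁↦w i₂↦w = begin
    indeg n (S₁ , S₂) w                                     ≡⟨ cong sum (map-tabulate id (λ i → F₁ i + F₂ i)) ⟩
    sum (List.tabulate (λ i → F₁ i + F₂ i))                      ≡⟨ sum-tabulate-+ F₁ F₂ ⟩
    sum (List.tabulate F₁) + sum (List.tabulate F₂)                   ≡⟨ cong₂ _+_ (count-arcs-into 1 S₁ w i₁ (≤-trans (s≤s z≤n) 2≤n) i₁↦w)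
                                                                          (count-arcs-into 2 S₂ w i₂ 2≤n i₂↦w) ⟩
    (if lookup S₁ i₁ then 1 else 0) + (if lookup S₂ i₂ then 1 else 0) ∎
    where
    open ≡-Reasoning
    F₁ F₂ : Fin n → ℕ
    F₁ i = if lookup S₁ i ∧ does (tgt₁ n i ≟ w) then 1 else 0
    F₂ i = if lookup S₂ i ∧ does (tgt₂ n i ≟ w) then 1 else 0

module _ {n : ℕ} .{{_ : NonZero n}} {u : Fin n} {S : Subgraph n} (T : IsRootedSpanningTree n u S) where

  open IsRootedSpanningTree T

  tree-reaches : ∀ w → Star (Arc n S) u w
  tree-reaches w with w ≟ u
  ... | yes refl = ε
  ... | no w≢u   = reachable w w≢u

  tree-no-arc-into-root : ∀ {y} → ¬ Arc n S y u
  tree-no-arc-into-root a = noClosedPath u (star-then-arc (tree-reaches _) a)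

module SquareCycle (n : ℕ) .{{_ : NonZero n}} (2≤n : 2 ≤ n) (root : Fin n) where

  open Arcs n

  pos : Fin n → ℕ
  pos w = (toℕ w + (n ∸ toℕ root)) % n

  vertex : ℕ → Fin n
  vertex p = fromℕ< (m%n<n (toℕ root + p) n)

  pos<n : ∀ w → pos w < n
  pos<n w = m%n<n _ n

  private
    root+p+[n∸root]≡p+n : ∀ p → toℕ root + p + (n ∸ toℕ root) ≡ p + n
    root+p+[n∸root]≡p+n p = begin
      toℕ root + p + (n ∸ toℕ root)  ≡⟨ cong (_+ (n ∸ toℕ root)) (+-comm (toℕ root) p) ⟩
      p + toℕ root + (n ∸ toℕ root)  ≡⟨ +-assoc p (toℕ root) _ ⟩
      p + (toℕ root + (n ∸ toℕ root)) ≡⟨ cong (p +_) (m+[n∸m]≡n (<⇒≤ (toℕ<n root))) ⟩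
      p + n                           ∎
      where open ≡-Reasoning

  pos-vertex : ∀ p → pos (vertex p) ≡ p % n
  pos-vertex p = begin
    (toℕ (vertex p) + (n ∸ toℕ root)) % n   ≡⟨ cong (λ x → (x + (n ∸ toℕ root)) % n) (toℕ-fromℕ< _) ⟩
    ((toℕ root + p) % n + (n ∸ toℕ root)) % n ≡⟨ [m%n+k]%n≡[m+k]%n n (toℕ root + p) _ ⟩
    (toℕ root + p + (n ∸ toℕ root)) % n     ≡⟨ cong (_% n) (root+p+[n∸root]≡p+n p) ⟩
    (p + n) % n                            ≡⟨ [m+n]%n≡m%n p n ⟩
    p % n                                  ∎
    where open ≡-Reasoning

  vertex-pos : ∀ w → vertex (pos w) ≡ w
  vertex-pos w = toℕ-injective (begin
    toℕ (vertex (pos w))                              ≡⟨ toℕ-fromℕ< _ ⟩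
    (toℕ root + pos w) % n                            ≡⟨ [m+k%n]%n≡[m+k]%n n (toℕ root) _ ⟩
    (toℕ root + (toℕ w + (n ∸ toℕ root))) % n         ≡⟨ cong (_% n) (+-assoc (toℕ root) (toℕ w) _) ⟨
    (toℕ root + toℕ w + (n ∸ toℕ root)) % n           ≡⟨ cong (_% n) (root+p+[n∸root]≡p+n (toℕ w)) ⟩
    (toℕ w + n) % n                                   ≡⟨ [m+n]%n≡m%n (toℕ w) n ⟩
    toℕ w % n                                         ≡⟨ m<n⇒m%n≡m (toℕ<n w) ⟩
    toℕ w                                             ∎)
    where open ≡-Reasoning

  pos-injective : ∀ {w w′} → pos w ≡ pos w′ → w ≡ w′
  pos-injective {w} {w′} eq = trans (sym (vertex-pos w)) (trans (cong vertex eq) (vertex-pos w′))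

  vertex-% : ∀ p → vertex (p % n) ≡ vertex p
  vertex-% p = trans (cong vertex (sym (pos-vertex p))) (vertex-pos (vertex p))

  pos-root : pos root ≡ 0
  pos-root = trans (cong (_% n) (m+[n∸m]≡n (<⇒≤ (toℕ<n root)))) (n%n≡0 n)

  pos≡0⇒root : ∀ {w} → pos w ≡ 0 → w ≡ root
  pos≡0⇒root eq = pos-injective (trans eq (sym pos-root))

  vertex-0 : vertex 0 ≡ root
  vertex-0 = trans (cong vertex (sym pos-root)) (vertex-pos root)

  pos-shift : ∀ k i → pos (shift k i) ≡ (pos i + k) % n
  pos-shift k i = begin
    (toℕ (shift k i) + (n ∸ toℕ root)) % n      ≡⟨ cong (λ x → (x + (n ∸ toℕ root)) % n) (toℕ-shift k i) ⟩
    ((toℕ i + k) % n + (n ∸ toℕ root)) % n      ≡⟨ [m%n+k]%n≡[m+k]%n n (toℕ i + k) _ ⟩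
    (toℕ i + k + (n ∸ toℕ root)) % n            ≡⟨ cong (_% n) (+-rotate (toℕ i) k _) ⟩
    (toℕ i + (n ∸ toℕ root) + k) % n            ≡⟨ [m%n+k]%n≡[m+k]%n n (toℕ i + (n ∸ toℕ root)) k ⟨
    (pos i + k) % n                            ∎
    where
    open ≡-Reasoning
    +-rotate : ∀ a b c → a + b + c ≡ a + c + b
    +-rotate a b c = trans (+-assoc a b c) (trans (cong (a +_) (+-comm b c)) (sym (+-assoc a c b)))

  shift-vertex : ∀ k p → shift k (vertex p) ≡ vertex (k + p)
  shift-vertex k p = pos-injective (begin
    pos (shift k (vertex p))     ≡⟨ pos-shift k (vertex p) ⟩
    (pos (vertex p) + k) % n     ≡⟨ cong (λ x → (x + k) % n) (pos-vertex p) ⟩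
    (p % n + k) % n              ≡⟨ [m%n+k]%n≡[m+k]%n n p k ⟩
    (p + k) % n                  ≡⟨ cong (_% n) (+-comm p k) ⟩
    (k + p) % n                  ≡⟨ pos-vertex (k + p) ⟨
    pos (vertex (k + p))         ∎)
    where open ≡-Reasoning

  1≤n : 1 ≤ n
  1≤n = ≤-trans (s≤s z≤n) 2≤n

  pos-vertex-< : ∀ {p} → p < n → pos (vertex p) ≡ p
  pos-vertex-< {p} p<n = trans (pos-vertex p) (m<n⇒m%n≡m p<n)

  vertex-+n : ∀ p → vertex (p + n) ≡ vertex p
  vertex-+n p = trans (sym (vertex-% (p + n))) (trans (cong vertex ([m+n]%n≡m%n p n)) (vertex-% p))

  vertex-wrap : vertex (2 + (n ∸ 1)) ≡ vertex 1
  vertex-wrap = trans (cong (vertex ∘ suc) (m+[n∸m]≡n 1≤n)) (vertex-+n 1)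

  shift-vertex-back : ∀ k p → k ≤ n → shift k (vertex (p + (n ∸ k))) ≡ vertex p
  shift-vertex-back k p k≤n = begin
    shift k (vertex (p + (n ∸ k)))  ≡⟨ shift-vertex k _ ⟩
    vertex (k + (p + (n ∸ k)))      ≡⟨ cong vertex (+-comm k _) ⟩
    vertex (p + (n ∸ k) + k)        ≡⟨ cong vertex (+-assoc p _ k) ⟩
    vertex (p + (n ∸ k + k))        ≡⟨ cong (λ m → vertex (p + m)) (m∸n+n≡m k≤n) ⟩
    vertex (p + n)                  ≡⟨ vertex-+n p ⟩
    vertex p                        ∎
    where open ≡-Reasoning

  -- For a position q ≥ 1, cs ! (q ∸ 1) is true when the parent of q is q − 1 and false when it is q − 2.
  usesArc₁ usesArc₂ : List Bool → ℕ → Bool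
  usesArc₁ cs zero    = false
  usesArc₁ cs (suc q) = cs ! q
  usesArc₂ cs zero    = false
  usesArc₂ cs (suc q) = not (cs ! q)

  encode : List Bool → Subgraph n
  encode cs = tabulate (λ i → usesArc₁ cs (pos (shift 1 i))) , tabulate (λ i → usesArc₂ cs (pos (shift 2 i)))

  extract : Subgraph n → List Bool
  extract (S₁ , _) = applyUpTo (λ q → lookup S₁ (vertex q)) (n ∸ 1)

  origin : Bool → ℕ
  origin true  = 0
  origin false = 1

  module _ (cs : List Bool) where

    uses-exclusive : ∀ q → usesArc₁ cs q ≡ true → usesArc₂ cs q ≡ true → ⊥
    uses-exclusive (suc q) u₁ u₂ with cs ! q
    uses-exclusive (suc q) refl () | true

    arc₁ : ∀ p → usesArc₁ cs (pos (vertex (1 + p))) ≡ true → Arc n (encode cs) (vertex p) (vertex (1 + p))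
    arc₁ p used = inj₁ (vertex p , lookup-used , src-i≡i _ , shift-vertex 1 p)
      where
      lookup-used : lookup (proj₁ (encode cs)) (vertex p) ≡ true
      lookup-used = trans (lookup∘tabulate _ (vertex p)) (trans (cong (usesArc₁ cs ∘ pos) (shift-vertex 1 p)) used)

    arc₂ : ∀ p → usesArc₂ cs (pos (vertex (2 + p))) ≡ true → Arc n (encode cs) (vertex p) (vertex (2 + p))
    arc₂ p used = inj₂ (vertex p , lookup-used , src-i≡i _ , shift-vertex 2 p)
      where
      lookup-used : lookup (proj₂ (encode cs)) (vertex p) ≡ true
      lookup-used = trans (lookup∘tabulate _ (vertex p)) (trans (cong (usesArc₂ cs ∘ pos) (shift-vertex 2 p)) used)

    PositionArc : ℕ → ℕ → Set
    PositionArc p q = (usesArc₁ cs q ≡ true × q ≡ (p + 1) % n) ⊎ (usesArc₂ cs q ≡ true × q ≡ (p + 2) % n)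

    arc⇒PositionArc : ∀ {y x} → Arc n (encode cs) y x → PositionArc (pos y) (pos x)
    arc⇒PositionArc (inj₁ (i , used , refl , refl)) rewrite src-i≡i i = inj₁ (trans (sym (lookup∘tabulate _ i)) used , pos-shift 1 i)
    arc⇒PositionArc (inj₂ (i , used , refl , refl)) rewrite src-i≡i i = inj₂ (trans (sym (lookup∘tabulate _ i)) used , pos-shift 2 i)

    no-arc-into-root : ∀ {y} → ¬ Arc n (encode cs) y root
    no-arc-into-root a with arc⇒PositionArc a
    ... | inj₁ (used , _) with () ← trans (cong (usesArc₁ cs) (sym pos-root)) used
    ... | inj₂ (used , _) with () ← trans (cong (usesArc₂ cs) (sym pos-root)) used

    predecessor-unique : ∀ {y y′ x} → Arc n (encode cs) y x → Arc n (encode cs) y′ x → y ≡ y′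
    predecessor-unique {y} {y′} {x} a b with arc⇒PositionArc a | arc⇒PositionArc b
    ... | inj₁ (_ , e) | inj₁ (_ , e′) = pos-injective ([a+k]%n≡[b+k]%n⇒a≡b n 1 (pos<n y) (pos<n y′) 1≤n (trans (sym e) e′))
    ... | inj₂ (_ , e) | inj₂ (_ , e′) = pos-injective ([a+k]%n≡[b+k]%n⇒a≡b n 2 (pos<n y) (pos<n y′) 2≤n (trans (sym e) e′))
    ... | inj₁ (u₁ , _) | inj₂ (u₂ , _) = ⊥-elim (uses-exclusive (pos x) u₁ u₂)
    ... | inj₂ (u₂ , _) | inj₁ (u₁ , _) = ⊥-elim (uses-exclusive (pos x) u₁ u₂)

    one-parent : ∀ q → q ≢ 0 → (if usesArc₁ cs q then 1 else 0) + (if usesArc₂ cs q then 1 else 0) ≡ 1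
    one-parent zero    q≢0 = ⊥-elim (q≢0 refl)
    one-parent (suc q) _   with cs ! q
    ... | true  = refl
    ... | false = refl

    indeg-encode : ∀ w → w ≢ root → indeg n (encode cs) w ≡ 1
    indeg-encode w w≢root = begin
      indeg n (encode cs) w
        ≡⟨ indeg≡indicators (proj₁ (encode cs)) (proj₂ (encode cs)) w i₁ i₂ 2≤n i₁↦w i₂↦w ⟩
      (if lookup (proj₁ (encode cs)) i₁ then 1 else 0) + (if lookup (proj₂ (encode cs)) i₂ then 1 else 0)
        ≡⟨ cong₂ (λ a b → (if a then 1 else 0) + (if b then 1 else 0))
                 (trans (lookup∘tabulate _ i₁) (cong (usesArc₁ cs ∘ pos) i₁↦w))
                 (trans (lookup∘tabulate _ i₂) (cong (usesArc₂ cs ∘ pos) i₂↦w)) ⟩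
      (if usesArc₁ cs (pos w) then 1 else 0) + (if usesArc₂ cs (pos w) then 1 else 0)
        ≡⟨ one-parent (pos w) (w≢root ∘ pos≡0⇒root) ⟩
      1 ∎
      where
      open ≡-Reasoning
      i₁ i₂ : Fin n
      i₁ = vertex (pos w + (n ∸ 1))
      i₂ = vertex (pos w + (n ∸ 2))
      i₁↦w : shift 1 i₁ ≡ w
      i₁↦w = trans (shift-vertex-back 1 (pos w) 1≤n) (vertex-pos w)
      i₂↦w : shift 2 i₂ ≡ w
      i₂↦w = trans (shift-vertex-back 2 (pos w) 2≤n) (vertex-pos w)

    arc-wrap : cs ! 0 ≡ false → Arc n (encode cs) (vertex (n ∸ 1)) (vertex 1)
    arc-wrap c₁ = subst (Arc n (encode cs) (vertex (n ∸ 1))) vertex-wrap (arc₂ (n ∸ 1) used)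
      where
      used : usesArc₂ cs (pos (vertex (2 + (n ∸ 1)))) ≡ true
      used = trans (cong (usesArc₂ cs ∘ pos) vertex-wrap) (trans (cong (usesArc₂ cs) (pos-vertex-< 2≤n)) (cong not c₁))

    parent-step : ∀ p → 2 + p < n → ∀ {x₁ x₀} →
      Star (Arc n (encode cs)) (vertex (origin x₁)) (vertex (1 + p)) →
      Star (Arc n (encode cs)) (vertex (origin x₀)) (vertex p) →
      Star (Arc n (encode cs)) (vertex (origin (if cs ! suc p then x₁ else x₀))) (vertex (2 + p))
    parent-step p p+2<n r₁ r₀ with cs ! suc p in c
    ... | true  = r₁ ◅◅ (arc₁ (suc p) (trans (cong (usesArc₁ cs) (pos-vertex-< p+2<n)) c) ◅ ε)
    ... | false = r₀ ◅◅ (arc₂ p (trans (cong (usesArc₂ cs) (pos-vertex-< p+2<n)) (cong not c)) ◅ ε)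

    reach-from-origin : ∀ p → p < n → Star (Arc n (encode cs)) (vertex (origin (rootward cs p))) (vertex p)
    reach-from-origin zero _ rewrite rootward-0 cs = ε
    reach-from-origin (suc zero) 1<n rewrite rootward-1 cs with cs ! 0 in c₁
    ... | true  = arc₁ 0 (trans (cong (usesArc₁ cs) (pos-vertex-< 1<n)) c₁) ◅ ε
    ... | false = ε
    reach-from-origin (suc (suc p)) p+2<n =
      subst (λ b → Star (Arc n (encode cs)) (vertex (origin b)) (vertex (2 + p))) (sym (rootward-2+ cs p))
            (parent-step p p+2<n (reach-from-origin (suc p) p+1<n) (reach-from-origin p (<-trans (n<1+n p) p+1<n)))
      where
      p+1<n : 1 + p < n
      p+1<n = <-trans (n<1+n _) p+2<n

  n∸1<n : n ∸ 1 < n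
  n∸1<n = ∸-monoʳ-< (s≤s z≤n) 1≤n

  encode-tree : ∀ cs → length cs ≡ n ∸ 1 → accepts (false , true) cs ≡ true → IsRootedSpanningTree n root (encode cs)
  encode-tree cs len acc = record
    { connected    = λ a b → reverse bwd (reach a) ◅◅ gmap id fwd (reach b)
    ; noClosedPath = rooted⇒acyclic (predecessor-unique cs) root (no-arc-into-root cs) reach
    ; indegOne     = indeg-encode cs
    ; reachable    = λ w _ → reach w
    }
    where
    rootward-last : rootward cs (n ∸ 1) ≡ true
    rootward-last = trans (cong (rootward cs) (sym len)) (trans (sym (accepts≡label _ cs)) acc)
    reach-1 : Star (Arc n (encode cs)) (vertex 0) (vertex 1)
    reach-1 with cs ! 0 in c₁
    ... | true  = arc₁ cs 0 (trans (cong (usesArc₁ cs) (pos-vertex-< 2≤n)) c₁) ◅ ε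
    ... | false = subst (λ b → Star (Arc n (encode cs)) (vertex (origin b)) (vertex (n ∸ 1))) rootward-last
                        (reach-from-origin cs (n ∸ 1) n∸1<n)
                  ◅◅ (arc-wrap cs c₁ ◅ ε)
    reach-origin : ∀ b → Star (Arc n (encode cs)) (vertex 0) (vertex (origin b))
    reach-origin true  = ε
    reach-origin false = reach-1
    reach : ∀ w → Star (Arc n (encode cs)) root w
    reach w = subst₂ (Star (Arc n (encode cs))) vertex-0 (vertex-pos w)
                     (reach-origin _ ◅◅ reach-from-origin cs (pos w) (pos<n w))

  tree⇒accepts : ∀ cs → length cs ≡ n ∸ 1 → IsRootedSpanningTree n root (encode cs) → accepts (false , true) cs ≡ true
  tree⇒accepts []           len _ = ⊥-elim (<⇒≢ (m<n⇒0<n∸m 2≤n) len)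
  tree⇒accepts (true ∷ bs)  _   _ = accepts-tt bs
  tree⇒accepts cs@(false ∷ _) len T with rootward cs (n ∸ 1) in r
  ... | true  = trans (accepts≡label _ cs) (trans (cong (rootward cs) len) r)
  ... | false = ⊥-elim (IsRootedSpanningTree.noClosedPath T (vertex 1) (star-then-arc 1↝*n-1 (arc-wrap cs refl)))
    where
    1↝*n-1 : Star (Arc n (encode cs)) (vertex 1) (vertex (n ∸ 1))
    1↝*n-1 = subst (λ b → Star (Arc n (encode cs)) (vertex (origin b)) (vertex (n ∸ 1))) r (reach-from-origin cs (n ∸ 1) n∸1<n)

  length-extract : ∀ S → length (extract S) ≡ n ∸ 1
  length-extract S = length-applyUpTo _ (n ∸ 1)

  extract-! : ∀ S q → 1 + q < n → extract S ! q ≡ lookup (proj₁ S) (vertex q)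
  extract-! S q q+1<n = !-applyUpTo (λ p → lookup (proj₁ S) (vertex p)) (n ∸ 1) q (∸-monoˡ-≤ 1 q+1<n)

  extract-encode : ∀ cs → length cs ≡ n ∸ 1 → extract (encode cs) ≡ cs
  extract-encode cs len = subst (λ m → applyUpTo f m ≡ cs) len (applyUpTo-! f cs agrees)
    where
    f : ℕ → Bool
    f q = lookup (proj₁ (encode cs)) (vertex q)
    agrees : ∀ q → q < length cs → f q ≡ cs ! q
    agrees q q<len =
      trans (lookup∘tabulate _ (vertex q)) (cong (usesArc₁ cs) (trans (cong pos (shift-vertex 1 q)) (pos-vertex-< 1+q<n)))
      where
      1+q<n : 1 + q < n
      1+q<n = subst (1 + q <_) (m+[n∸m]≡n 1≤n) (s≤s (subst (q <_) len q<len))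

  indicators-sum-1 : ∀ a b → (if a then 1 else 0) + (if b then 1 else 0) ≡ 1 → b ≡ not a
  indicators-sum-1 true  false _ = refl
  indicators-sum-1 false true  _ = refl

  encode-extract : ∀ S → IsRootedSpanningTree n root S → encode (extract S) ≡ S
  encode-extract (S₁ , S₂) T =
    cong₂ _,_ (trans (tabulate-cong agrees₁) (tabulate∘lookup S₁)) (trans (tabulate-cong agrees₂) (tabulate∘lookup S₂))
    where
    cs : List Bool
    cs = extract (S₁ , S₂)
    into-root₁ : ∀ i → pos (shift 1 i) ≡ 0 → false ≡ lookup S₁ i
    into-root₁ i e with lookup S₁ i in used
    ... | true  = ⊥-elim (tree-no-arc-into-root T (inj₁ (i , used , src-i≡i i , pos≡0⇒root e)))
    ... | false = refl
    into-root₂ : ∀ i → pos (shift 2 i) ≡ 0 → false ≡ lookup S₂ i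
    into-root₂ i e with lookup S₂ i in used
    ... | true  = ⊥-elim (tree-no-arc-into-root T (inj₂ (i , used , src-i≡i i , pos≡0⇒root e)))
    ... | false = refl
    from-previous : ∀ {k} i q → pos (shift k i) ≡ suc q → shift 1 (vertex q) ≡ shift k i
    from-previous {k} i q e = trans (shift-vertex 1 q) (trans (cong vertex (sym e)) (vertex-pos (shift k i)))
    agrees₁ : ∀ i → usesArc₁ cs (pos (shift 1 i)) ≡ lookup S₁ i
    agrees₁ i with pos (shift 1 i) in e
    ... | zero  = into-root₁ i e
    ... | suc q = trans (extract-! (S₁ , S₂) q (subst (_< n) e (pos<n _))) (cong (lookup S₁) (shift-injective 1≤n (from-previous i q e)))
    agrees₂ : ∀ i → usesArc₂ cs (pos (shift 2 i)) ≡ lookup S₂ i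
    agrees₂ i with pos (shift 2 i) in e
    ... | zero  = into-root₂ i e
    ... | suc q = trans (cong not (extract-! (S₁ , S₂) q (subst (_< n) e (pos<n _)))) (sym (indicators-sum-1 _ _ one))
      where
      w≢root : shift 2 i ≢ root
      w≢root w≡root = 0≢1+n (trans (sym pos-root) (trans (cong pos (sym w≡root)) e))
      one : (if lookup S₁ (vertex q) then 1 else 0) + (if lookup S₂ i then 1 else 0) ≡ 1
      one = trans (sym (indeg≡indicators S₁ S₂ (shift 2 i) (vertex q) i 2≤n (from-previous i q e) refl))
                  (IsRootedSpanningTree.indegOne T (shift 2 i) w≢root)

  trees : List (Subgraph n)
  trees = map encode (words (n ∸ 1) (false , true))

  count-trees : NumRootedSpanningTrees n root (J n)
  count-trees = trees , trees-unique , (λ S → mk⇔ (∈trees⇒tree S) (tree⇒∈trees S)) , length-trees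
    where
    ws : List (List Bool)
    ws = words (n ∸ 1) (false , true)
    extract-encode-ws : All (λ cs → extract (encode cs) ≡ cs) ws
    extract-encode-ws = All.tabulate λ {cs} m → extract-encode cs (proj₁ (∈-words⁻ (n ∸ 1) (false , true) cs m))
    map-extract-trees : map extract trees ≡ ws
    map-extract-trees = trans (sym (map-∘ {g = extract} {f = encode} ws)) (map-id-local extract-encode-ws)
    trees-unique : Unique trees
    trees-unique = Unique.map⁻ {f = extract} (subst Unique (sym map-extract-trees) (words-unique (n ∸ 1) (false , true)))
    ∈trees⇒tree : ∀ S → S ∈ trees → IsRootedSpanningTree n root S
    ∈trees⇒tree S m with ∈-map⁻ encode m
    ... | cs , m′ , refl with ∈-words⁻ (n ∸ 1) (false , true) cs m′
    ...   | len , acc = encode-tree cs len acc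
    tree⇒∈trees : ∀ S → IsRootedSpanningTree n root S → S ∈ trees
    tree⇒∈trees S T = subst (_∈ trees) (encode-extract S T)
      (∈-map⁺ encode (∈-words⁺ (n ∸ 1) (false , true) (extract S) (length-extract S)
        (tree⇒accepts (extract S) (length-extract S) (subst (IsRootedSpanningTree n root) (sym (encode-extract S T)) T))))
    length-trees : length trees ≡ J n
    length-trees = trans (length-map encode ws) (trans (length-words-ft (n ∸ 1)) (cong J (m+[n∸m]≡n 1≤n)))

theorem4p2 : (n : ℕ) .{{_ : NonZero n}} → 5 ≤ n → (j : ℤ) →
    NumRootedSpanningTrees n (v n j) (J n)
theorem4p2 n 5≤n j = SquareCycle.count-trees n (≤-trans (s≤s (s≤s z≤n)) 5≤n) (v n j)
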